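{- Let $n\ge 1$ and let $H$ be a circulant Hadamard matrix of order $4n$ with binary generator polynomial $g\in\mathbb{F}_2[x]/(x^{4n}-1)$. Let $\mathbf{u}=1+x+\dots+x^{4n-1}$ be the polynomial with all coefficients one, and let $$C=\{\,g+x^ig+\xi\mathbf{u} \;:\; 0\le i\le 4n-1,\ \xi\in\mathbb{F}_2\,\}\subseteq \mathbb{F}_2[x]/(x^{4n}-1)\cong\mathbb{F}_2^{4n},$$ equipped with the operation $*$ defined by $$(g+x^ig+\xi\mathbf{u})*(g+x^jg+\xi'\mathbf{u})=g+x^{i+j}g+(\xi+\xi')\mathbf{u}\quad\text{for all } i,j\in\{0,\dots,4n-1\},\ \xi,\xi'\in\mathbb{F}_2 .$$ Then $(C,*)$ is a Hadamard full propelinear code ($\mathrm{HFP}$-code) whose group of associated permutations $\Pi=\{\pi_{\mathbf{z}}:\mathbf{z}\in C\}$ is cyclic of order $4n$ (the permutation associated to $g+x^ig+\xi\mathbf{u}$ being the cyclic shift by $i$ positions); its type is $C_{4n}\times C_2$ with $\mathbf{u}$ generating the factor $C_2$.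
   Context: $\mathbb{F}_2$ is the binary field; vectors of $\mathbb{F}_2^{4n}$ are identified with polynomials in $\mathbb{F}_2[x]/(x^{4n}-1)$ via their coefficients, and multiplication by $x^i$ is the cyclic shift by $i$ positions. A circulant Hadamard matrix of order $4n$ is a $4n\times 4n$ matrix with entries in $\{1,-1\}$ whose rows are $(a_1,\dots,a_{4n})$ and its successive cyclic shifts (row $k+1$ is row $k$ shifted cyclically one position to the right), satisfying $HH^T=4nI$. Its binary generator polynomial is $g=g_1+g_2x+\dots+g_{4n}x^{4n-1}$ with $g_i=0$ if $a_i=1$ and $g_i=1$ if $a_i=-1$. A binary Hadamard code of length $4n$ is obtained from a normalized Hadamard matrix (first row and column all $+1$) by replacing $+1$ by $0$ and $-1$ by $1$ and taking the rows together with their complements; equivalently (for codes containing $\mathbf{0}$) a set of $8n$ vectors in which distinct non-complementary vectors are at Hamming distance $2n$. A binary code $C$ of length $N$ is propelinear if for each $\mathbf{x}\in C$ there is a coordinate permutation $\pi_{\mathbf{x}}$ such that for all $\mathbf{y}\in C$: $\mathbf{x}+\pi_{\mathbf{x}}(\mathbf{y})\in C$ and $\pi_{\mathbf{x}}\pi_{\mathbf{y}}=\pi_{\mathbf{z}}$ where $\mathbf{z}=\mathbf{x}+\pi_{\mathbf{x}}(\mathbf{y})$; the operation is $\mathbf{x}*\mathbf{y}=\mathbf{x}+\pi_{\mathbf{x}}(\mathbf{y})$, making $(C,*)$ a group whose isomorphism type is called the type of $C$. An $\mathrm{HFP}$-code is a propelinear code that is also a Hadamard code, such that $\pi_{\mathbf{0}}=\pi_{\mathbf{u}}$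 is the identity and for every $\mathbf{a}\in C\setminus\{\mathbf{0},\mathbf{u}\}$ the permutation $\pi_{\mathbf{a}}$ has no fixed coordinate. -}

module Defs where

open import Data.Nat using (ℕ; zero; suc; _+_; _*_; _∸_; _<_; NonZero; >-nonZero⁻¹)
open import Data.Nat.Properties using (m*n≢0)
open import Data.Nat.DivMod using (_%_; m%n<n)
open import Data.Fin using (Fin; toℕ; fromℕ<) renaming (_≟_ to _≟F_)
open import Data.Bool using (Bool; true; false; _xor_; not; if_then_else_)
open import Data.Vec using (Vec; []; _∷_; tabulate; lookup; zipWith; replicate; map)
open import Data.Integer as ℤ using (ℤ; +_; -[1+_])
open import Data.Fin.Permutation using (Permutation′; _⟨$⟩ʳ_; _⟨$⟩ˡ_; _≈_; id; _∘ₚ_)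
open import Data.Product using (Σ; ∃; _×_; _,_)
open import Data.Sum using (_⊎_)
open import Relation.Nullary using (¬_; does)
open import Relation.Binary.PropositionalEquality using (_≡_; _≢_)

sumFin : ∀ {m} → (Fin m → ℤ) → ℤ
sumFin {zero} f = + 0
sumFin {suc m} f = f Fin.zero ℤ.+ sumFin (λ k → f (Fin.suc k))

weight : ∀ {m} → Vec Bool m → ℕ
weight [] = 0
weight (true ∷ v) = suc (weight v)
weight (false ∷ v) = weight v

module Len (n : ℕ) .{{nzn : NonZero n}} where

  N : ℕ
  N = 4 * n

  instance
    nzN : NonZero N
    nzN = m*n≢0 4 n

  -- binary vectors of length N = elements of F_2[x]/(x^N - 1)
  -- (coordinate k = coefficient of x^k, k = 0 .. N-1)
  BinVec : Set
  BinVec = Vec Bool N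

  _⊞_ : Fin N → ℕ → Fin N
  k ⊞ i = fromℕ< (m%n<n (toℕ k + i) N)

  _⊟_ : Fin N → ℕ → Fin N
  k ⊟ i = fromℕ< (m%n<n (toℕ k + (N ∸ (i % N))) N)

  0F : Fin N
  0F = fromℕ< (>-nonZero⁻¹ N)

  _⊕_ : BinVec → BinVec → BinVec
  _⊕_ = zipWith _xor_

  -- multiplication by x^i: cyclic shift by i positions (coefficient of x^k in x^i v is v_{k-i})
  xpow : ℕ → BinVec → BinVec
  xpow i v = tabulate (λ k → lookup v (k ⊟ i))

  zeroV : BinVec
  zeroV = replicate N false

  u : BinVec
  u = replicate N true

  scaleU : Bool → BinVec
  scaleU ξ = map (λ b → Data.Bool._∧_ ξ b) u

  complement : BinVec → BinVec
  complement = map not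

  dist : BinVec → BinVec → ℕ
  dist x y = weight (x ⊕ y)

  -- circulant matrix whose row 0 is a, row r+1 = row r shifted right by one
  circ : (Fin N → ℤ) → Fin N → Fin N → ℤ
  circ a r c = a (c ⊟ toℕ r)

  IsCirculantHadamard : (Fin N → ℤ) → Set
  IsCirculantHadamard a =
    (∀ k → a k ≡ + 1 ⊎ a k ≡ -[1+ 0 ]) ×
    (∀ r s → sumFin (λ c → circ a r c ℤ.* circ a s c)
               ≡ (if does (r ≟F s) then + N else + 0))

  genPoly : (Fin N → ℤ) → BinVec
  genPoly a = tabulate (λ k → does (a k ℤ.≟ -[1+ 0 ]))

  cw : BinVec → ℕ → Bool → BinVec
  cw g i ξ = (g ⊕ xpow i g) ⊕ scaleU ξ

  InC : BinVec → BinVec → Set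
  InC g v = ∃ λ (i : Fin N) → ∃ λ (ξ : Bool) → v ≡ cw g (toℕ i) ξ

  HasSize : (BinVec → Set) → ℕ → Set
  HasSize C m = Σ (Fin m → BinVec) λ e →
    (∀ p q → e p ≡ e q → p ≡ q) × (∀ v → C v → ∃ λ p → e p ≡ v) × (∀ p → C (e p))

  IsHadamardCode : (BinVec → Set) → Set
  IsHadamardCode C =
    C zeroV × HasSize C (2 * N) ×
    (∀ x y → C x → C y → x ≢ y → x ≢ complement y → dist x y ≡ 2 * n)

  -- action of a coordinate permutation on a vector: (π y)_{π(j)} = y_j
  act : Permutation′ N → BinVec → BinVec
  act π y = tabulate (λ k → lookup y (π ⟨$⟩ˡ k))

  star : (BinVec → Permutation′ N) → BinVec → BinVec → BinVec
  star π x y = x ⊕ act (π x) y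

  IsPropelinear : (BinVec → Set) → (BinVec → Permutation′ N) → Set
  IsPropelinear C π = ∀ x y → C x → C y →
    C (star π x y) × (∀ k → π x ⟨$⟩ʳ (π y ⟨$⟩ʳ k) ≡ π (star π x y) ⟨$⟩ʳ k)

  IsHFP : (BinVec → Set) → (BinVec → Permutation′ N) → Set
  IsHFP C π =
    IsPropelinear C π × IsHadamardCode C ×
    π zeroV ≈ id × π u ≈ id ×
    (∀ a → C a → a ≢ zeroV → a ≢ u → ∀ k → π a ⟨$⟩ʳ k ≢ k)

  powP : Permutation′ N → ℕ → Permutation′ N
  powP σ zero = id
  powP σ (suc k) = σ ∘ₚ powP σ k

  PiCyclicOfOrder : (BinVec → Set) → (BinVec → Permutation′ N) → ℕ → Set
  PiCyclicOfOrder C π m = Σ (Permutation′ N) λ σ →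
    (∀ z → C z → ∃ λ k → π z ≈ powP σ k) ×
    (∀ k → ∃ λ z → C z × π z ≈ powP σ k) ×
    powP σ m ≈ id ×
    (∀ k → 0 < k → k < m → ¬ (powP σ k ≈ id))

  TypeCN×C2 : (BinVec → Set) → (BinVec → Permutation′ N) → Set
  TypeCN×C2 C π = Σ (Fin N × Bool → BinVec) λ φ →
    (∀ p → C (φ p)) ×
    (∀ p q → φ p ≡ φ q → p ≡ q) ×
    (∀ v → C v → ∃ λ p → φ p ≡ v) ×
    (∀ i j ξ ξ′ → φ (i ⊞ toℕ j , ξ xor ξ′) ≡ star π (φ (i , ξ)) (φ (j , ξ′))) ×
    φ (0F , true) ≡ u

module Submission where

-- The argument has two independent halves.
--   * Combinatorial: the rows of H are the shifts xʳg, and HHᵀ = N·I says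
--     that distinct rows agree in exactly half of the positions, i.e. g is
--     difference-balanced: weight (xʳg + xˢg) = 2n for r ≠ s
--     (lemma hadamard⇒balanced, via the ±1 sum/weight identity signSum).
--   * Algebraic: for ANY difference-balanced g (module Code) the map
--     (i, ξ) ↦ g + xⁱg + ξu is injective (distinct i give distance 2n ≠ 0),
--     so the shift index of a codeword can be decoded, and the identity
--     (g + xⁱg + ξu) + xⁱ(g + xʲg + ξ′u) = g + x^{i+j}g + (ξ+ξ′)u
--     (cw-star) gives all the group-theoretic claims at once.

open import Defs
open import Data.Nat as ℕ using (ℕ; zero; suc; _+_; _*_; _∸_; _<_; NonZero)
open import Data.Nat.Properties
open import Data.Nat.DivMod
open import Data.Fin as F using (Fin; toℕ; fromℕ<)
open import Data.Fin.Properties using (toℕ-fromℕ<; toℕ-injective; toℕ<n; any?; 2↔Bool; *↔×)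
open import Data.Bool using (Bool; true; false; _xor_; not; _∧_; if_then_else_)
open import Data.Bool.Properties
  using (xor-∧-commutativeRing; xor-assoc; xor-comm; xor-same; xor-identityʳ; true-xor;
         not-injective; not-distribʳ-xor; ∧-identityʳ)
open import Data.Vec using (Vec; []; _∷_; tabulate; lookup; replicate; map)
open import Data.Vec.Properties using (lookup-zipWith; lookup-replicate; lookup∘tabulate; tabulate∘lookup; tabulate-cong; lookup-map; ≡-dec)
open import Data.Integer as ℤ using (ℤ; +_; -[1+_])
open import Data.Integer.Properties using (+-injective; pos-+)
open import Data.Integer.Tactic.RingSolver using (solve-∀)
open import Data.Fin.Permutation using (Permutation′; _⟨$⟩ʳ_; _≈_; id; permutation)
open import Data.Product using (Σ; ∃; _×_; _,_; proj₁)
open import Data.Product.Algebra using (×-cong; ×-comm)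
open import Data.Sum using (_⊎_; inj₁; inj₂; [_,_])
open import Data.Empty using (⊥-elim)
open import Function using (_∘_; _↔_; Inverse)
open import Function.Properties.Inverse using (↔-refl; ↔-trans)
open import Algebra.Bundles using (CommutativeRing)
open import Algebra.Properties.CommutativeSemigroup
  (CommutativeRing.+-commutativeSemigroup xor-∧-commutativeRing) using (interchange)
open import Relation.Nullary using (¬_; does; yes; no; Dec)
open import Relation.Binary.PropositionalEquality hiding ([_])

xor-cancel-middle : ∀ p q r → (p xor q) xor (q xor r) ≡ p xor r
xor-cancel-middle p q r = begin
  (p xor q) xor (q xor r) ≡⟨ xor-assoc p q (q xor r) ⟩
  p xor (q xor (q xor r)) ≡⟨ cong (p xor_) (sym (xor-assoc q q r)) ⟩
  p xor ((q xor q) xor r) ≡⟨ cong (λ t → p xor (t xor r)) (xor-same q) ⟩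
  p xor r                 ∎
  where open ≡-Reasoning

xor-injectiveʳ : ∀ x {a b} → x xor a ≡ x xor b → a ≡ b
xor-injectiveʳ false e = e
xor-injectiveʳ true  e = not-injective e

indicator : Bool → ℕ
indicator b = if b then 1 else 0

weight-cons : ∀ {m} b (v : Vec Bool m) → weight (b ∷ v) ≡ indicator b + weight v
weight-cons true  v = refl
weight-cons false v = refl

weight-complement : ∀ {m} (v : Vec Bool m) → weight (map not v) + weight v ≡ m
weight-complement []          = refl
weight-complement (true ∷ v)  = trans (+-suc _ _) (cong suc (weight-complement v))
weight-complement (false ∷ v) = cong suc (weight-complement v)

weight-zero : ∀ m → weight (replicate m false) ≡ 0
weight-zero zero    = refl
weight-zero (suc m) = weight-zero m

sign : Bool → ℤ
sign b = if b then -[1+ 0 ] else + 1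

bit : ℤ → Bool
bit x = does (x ℤ.≟ -[1+ 0 ])

sign-product : ∀ x y → (x ≡ + 1 ⊎ x ≡ -[1+ 0 ]) → (y ≡ + 1 ⊎ y ≡ -[1+ 0 ]) →
               x ℤ.* y ≡ sign (bit x xor bit y)
sign-product _ _ (inj₁ refl) (inj₁ refl) = refl
sign-product _ _ (inj₁ refl) (inj₂ refl) = refl
sign-product _ _ (inj₂ refl) (inj₁ refl) = refl
sign-product _ _ (inj₂ refl) (inj₂ refl) = refl

sumFin-cong : ∀ {m} {f f′ : Fin m → ℤ} → (∀ c → f c ≡ f′ c) → sumFin f ≡ sumFin f′
sumFin-cong {zero}  e = refl
sumFin-cong {suc m} e = cong₂ ℤ._+_ (e F.zero) (sumFin-cong (e ∘ F.suc))

-- Σ_c (-1)^{h c} = m - 2·weight h : each coordinate contributes 1 to both sides.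
signSum : ∀ m (h : Fin m → Bool) → sumFin (sign ∘ h) ℤ.+ + (2 * weight (tabulate h)) ≡ + m
signSum zero    h = refl
signSum (suc m) h = begin
  (sign b ℤ.+ S) ℤ.+ + (2 * weight (b ∷ v))
    ≡⟨ cong (λ t → (sign b ℤ.+ S) ℤ.+ t) double-weight ⟩
  (sign b ℤ.+ S) ℤ.+ (+ (2 * indicator b) ℤ.+ + (2 * weight v))
    ≡⟨ regroup (sign b) S (+ (2 * indicator b)) (+ (2 * weight v)) ⟩
  (sign b ℤ.+ + (2 * indicator b)) ℤ.+ (S ℤ.+ + (2 * weight v))
    ≡⟨ cong₂ ℤ._+_ (bit-contribution b) (signSum m (h ∘ F.suc)) ⟩
  + suc m ∎
  where
  open ≡-Reasoning
  b = h F.zero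
  v = tabulate (h ∘ F.suc)
  S = sumFin (sign ∘ h ∘ F.suc)
  double-weight : + (2 * weight (b ∷ v)) ≡ + (2 * indicator b) ℤ.+ + (2 * weight v)
  double-weight = trans (cong (λ w → + (2 * w)) (weight-cons b v))
    (trans (cong +_ (*-distribˡ-+ 2 (indicator b) (weight v))) (pos-+ (2 * indicator b) (2 * weight v)))
  regroup : ∀ x s y w → (x ℤ.+ s) ℤ.+ (y ℤ.+ w) ≡ (x ℤ.+ y) ℤ.+ (s ℤ.+ w)
  regroup = solve-∀
  bit-contribution : ∀ b → sign b ℤ.+ + (2 * indicator b) ≡ + 1
  bit-contribution true  = refl
  bit-contribution false = refl

module Shift (n : ℕ) .{{nzn : NonZero n}} where
  open Len n

  _≡ₘ_ : ℕ → ℕ → Set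
  x ≡ₘ y = x % N ≡ y % N

  +-congʳₘ : ∀ {x y} c → x ≡ₘ y → (x + c) ≡ₘ (y + c)
  +-congʳₘ {x} {y} c p = begin
    (x + c) % N             ≡⟨ %-distribˡ-+ x c N ⟩
    (x % N + c % N) % N     ≡⟨ cong (λ z → (z + c % N) % N) p ⟩
    (y % N + c % N) % N     ≡⟨ %-distribˡ-+ y c N ⟨
    (y + c) % N             ∎
    where open ≡-Reasoning

  +-congˡₘ : ∀ c {x y} → x ≡ₘ y → (c + x) ≡ₘ (c + y)
  +-congˡₘ c {x} {y} p =
    trans (cong (_% N) (+-comm c x)) (trans (+-congʳₘ c p) (cong (_% N) (+-comm y c)))

  mod-≡ₘ : ∀ x → (x % N) ≡ₘ x
  mod-≡ₘ x = m%n%n≡m%n x N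

  -- Adding i can be undone, since i + i(N-1) is a multiple of N.
  +-cancelʳₘ : ∀ {x y} i → (x + i) ≡ₘ (y + i) → x ≡ₘ y
  +-cancelʳₘ {x} {y} i p = trans (sym (absorb x)) (trans (+-congʳₘ (i * (N ∸ 1)) p) (absorb y))
    where
    multiple : i + i * (N ∸ 1) ≡ i * N
    multiple = trans (sym (*-suc i (N ∸ 1))) (cong (i *_) (suc-pred N))
    absorb : ∀ z → (z + i + i * (N ∸ 1)) % N ≡ z % N
    absorb z = trans (cong (_% N) (trans (+-assoc z i _) (cong (ℕ._+_ z) multiple)))
                     ([m+kn]%n≡m%n z i N)

  +-cancelˡₘ : ∀ {x y} i → (i + x) ≡ₘ (i + y) → x ≡ₘ y
  +-cancelˡₘ {x} {y} i p =
    +-cancelʳₘ i (trans (cong (_% N) (+-comm x i)) (trans p (cong (_% N) (+-comm i y))))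

  toℕ-%N : ∀ (k : Fin N) → toℕ k % N ≡ toℕ k
  toℕ-%N k = m<n⇒m%n≡m (toℕ<n k)

  toℕ-injectiveₘ : ∀ {k l : Fin N} → toℕ k ≡ₘ toℕ l → k ≡ l
  toℕ-injectiveₘ {k} {l} p = toℕ-injective (trans (sym (toℕ-%N k)) (trans p (toℕ-%N l)))

  toℕ-0F : toℕ 0F ≡ 0
  toℕ-0F = toℕ-fromℕ< _

  toℕ-⊞ : ∀ k i → toℕ (k ⊞ i) ≡ₘ (toℕ k + i)
  toℕ-⊞ k i = trans (cong (_% N) (toℕ-fromℕ< _)) (m%n%n≡m%n _ N)

  toℕ-⊟ : ∀ k i → (toℕ (k ⊟ i) + i) ≡ₘ toℕ k
  toℕ-⊟ k i = begin
    (toℕ (k ⊟ i) + i) % N      ≡⟨ +-congʳₘ i (trans (cong (_% N) (toℕ-fromℕ< _)) (mod-≡ₘ t)) ⟩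
    (t + i) % N                ≡⟨ +-congˡₘ t (mod-≡ₘ i) ⟨
    (t + i % N) % N            ≡⟨ cong (_% N) (+-assoc (toℕ k) _ _) ⟩
    (toℕ k + (N ∸ i % N + i % N)) % N ≡⟨ cong (λ z → (toℕ k + z) % N) (m∸n+n≡m (<⇒≤ (m%n<n i N))) ⟩
    (toℕ k + N) % N            ≡⟨ [m+n]%n≡m%n (toℕ k) N ⟩
    toℕ k % N                  ∎
    where
    open ≡-Reasoning
    t = toℕ k + (N ∸ i % N)

  ⊟-⊞-cancel : ∀ k i → (k ⊟ i) ⊞ i ≡ k
  ⊟-⊞-cancel k i = toℕ-injectiveₘ (trans (toℕ-⊞ (k ⊟ i) i) (toℕ-⊟ k i))

  ⊞-⊟-cancel : ∀ k i → (k ⊞ i) ⊟ i ≡ k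
  ⊞-⊟-cancel k i = toℕ-injectiveₘ (+-cancelʳₘ i (trans (toℕ-⊟ (k ⊞ i) i) (toℕ-⊞ k i)))

  ⊞-⊞ : ∀ k i j → (k ⊞ i) ⊞ j ≡ k ⊞ (i + j)
  ⊞-⊞ k i j = toℕ-injectiveₘ (trans (toℕ-⊞ (k ⊞ i) j) (trans (+-congʳₘ j (toℕ-⊞ k i))
    (trans (cong (_% N) (+-assoc (toℕ k) i j)) (sym (toℕ-⊞ k (i + j))))))

  ⊟-⊟ : ∀ k i j → (k ⊟ i) ⊟ j ≡ k ⊟ (i + j)
  ⊟-⊟ k i j = toℕ-injectiveₘ (+-cancelʳₘ (i + j) (trans reassociated (sym (toℕ-⊟ k (i + j)))))
    where
    x = toℕ ((k ⊟ i) ⊟ j)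
    reassociated : (x + (i + j)) ≡ₘ toℕ k
    reassociated = trans (cong (_% N) (trans (cong (ℕ._+_ x) (+-comm i j)) (sym (+-assoc x j i))))
                         (trans (+-congʳₘ i (toℕ-⊟ (k ⊟ i) j)) (toℕ-⊟ k i))

  ⊞-mod : ∀ k i → k ⊞ (i % N) ≡ k ⊞ i
  ⊞-mod k i = toℕ-injectiveₘ (trans (toℕ-⊞ k (i % N)) (trans (+-congˡₘ (toℕ k) (mod-≡ₘ i)) (sym (toℕ-⊞ k i))))

  ⊟-mod : ∀ k i → k ⊟ (i % N) ≡ k ⊟ i
  ⊟-mod k i = toℕ-injectiveₘ (+-cancelʳₘ i (trans (sym (+-congˡₘ (toℕ (k ⊟ (i % N))) (mod-≡ₘ i)))
                (trans (toℕ-⊟ k (i % N)) (sym (toℕ-⊟ k i)))))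

  ⊞-zero : ∀ k → k ⊞ 0 ≡ k
  ⊞-zero k = toℕ-injectiveₘ (trans (toℕ-⊞ k 0) (cong (_% N) (+-identityʳ _)))

  ⊟-zero : ∀ k → k ⊟ 0 ≡ k
  ⊟-zero k = toℕ-injectiveₘ (trans (cong (_% N) (sym (+-identityʳ _))) (toℕ-⊟ k 0))

  ⊞-N : ∀ k → k ⊞ N ≡ k
  ⊞-N k = toℕ-injectiveₘ (trans (toℕ-⊞ k N) ([m+n]%n≡m%n (toℕ k) N))

  ⊞-fixed⇒zero : ∀ k i → i < N → k ⊞ i ≡ k → i ≡ 0
  ⊞-fixed⇒zero k i i<N fixed = begin
    i          ≡⟨ m<n⇒m%n≡m i<N ⟨
    i % N      ≡⟨ +-cancelˡₘ (toℕ k) (trans (sym (toℕ-⊞ k i)) (trans (cong (λ z → toℕ z % N) fixed)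
                   (cong (_% N) (sym (+-identityʳ _))))) ⟩
    0 % N      ≡⟨ m<n⇒m%n≡m (ℕ.>-nonZero⁻¹ N) ⟩
    0          ∎
    where open ≡-Reasoning

  shift : ℕ → Permutation′ N
  shift i = permutation (_⊞ i) (_⊟ i) (λ k → ⊟-⊞-cancel k i) (λ k → ⊞-⊟-cancel k i)

module Vectors (n : ℕ) .{{nzn : NonZero n}} where
  open Len n

  ext : ∀ {v w : BinVec} → (∀ k → lookup v k ≡ lookup w k) → v ≡ w
  ext {v} {w} p = trans (sym (tabulate∘lookup v)) (trans (tabulate-cong p) (tabulate∘lookup w))

  lookup-⊕ : ∀ v w k → lookup (v ⊕ w) k ≡ lookup v k xor lookup w k
  lookup-⊕ v w k = lookup-zipWith _xor_ k v w

  lookup-xpow : ∀ i v k → lookup (xpow i v) k ≡ lookup v (k ⊟ i)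
  lookup-xpow i v k = lookup∘tabulate _ k

  lookup-scaleU : ∀ ξ k → lookup (scaleU ξ) k ≡ ξ
  lookup-scaleU ξ k = trans (lookup-map k _ u) (trans (cong (ξ ∧_) (lookup-replicate k true)) (∧-identityʳ ξ))

  lookup-complement : ∀ v k → lookup (complement v) k ≡ not (lookup v k)
  lookup-complement v k = lookup-map k not v

  lookup-genPoly : ∀ a k → lookup (genPoly a) k ≡ bit (a k)
  lookup-genPoly a k = lookup∘tabulate _ k

  hasSize-via : ∀ {m} {A : Set} {C : BinVec → Set} (e : Fin m ↔ A) (φ : A → BinVec) →
    (∀ p q → φ p ≡ φ q → p ≡ q) → (∀ v → C v → ∃ λ p → φ p ≡ v) → (∀ p → C (φ p)) →
    HasSize C m
  hasSize-via e φ φ-inj φ-onto φ-in =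
    φ ∘ to , (λ p q eq → trans (sym (from∘to p)) (trans (cong from (φ-inj _ _ eq)) (from∘to q))) ,
    (λ v v∈C → let (p , φp≡v) = φ-onto v v∈C in from p , trans (cong φ (to∘from p)) φp≡v) ,
    (λ p → φ-in (to p))
    where
    open Inverse e using (to; from)
    from∘to = Inverse.strictlyInverseʳ e
    to∘from = Inverse.strictlyInverseˡ e

  DifferenceBalanced : BinVec → Set
  DifferenceBalanced g = ∀ (r s : Fin N) → r ≢ s → weight (xpow (toℕ r) g ⊕ xpow (toℕ s) g) ≡ 2 * n

module Hadamard (n : ℕ) .{{nzn : NonZero n}} where
  open Len n
  open Vectors n

  -- Rows r ≠ s of H are orthogonal; as the entries are ±1 this says that
  -- N - 2·weight (xʳg + xˢg) = 0.
  hadamard⇒balanced : ∀ a → IsCirculantHadamard a → DifferenceBalanced (genPoly a)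
  hadamard⇒balanced a (±1 , orthogonal) r s r≢s =
    *-cancelˡ-≡ (weight d) (2 * n) 2 (trans (+-injective twice-weight) (*-assoc 2 2 n))
    where
    g = genPoly a
    d = xpow (toℕ r) g ⊕ xpow (toℕ s) g
    h : Fin N → Bool
    h = lookup d
    entry : ∀ c → circ a r c ℤ.* circ a s c ≡ sign (h c)
    entry c = trans (sign-product _ _ (±1 _) (±1 _)) (cong sign (sym (begin
      h c                                                       ≡⟨ lookup-⊕ (xpow (toℕ r) g) (xpow (toℕ s) g) c ⟩
      lookup (xpow (toℕ r) g) c xor lookup (xpow (toℕ s) g) c
        ≡⟨ cong₂ _xor_ (trans (lookup-xpow (toℕ r) g c) (lookup-genPoly a _))
                       (trans (lookup-xpow (toℕ s) g c) (lookup-genPoly a _)) ⟩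
      bit (circ a r c) xor bit (circ a s c)                     ∎)))
      where open ≡-Reasoning
    row-product-zero : sumFin (sign ∘ h) ≡ + 0
    row-product-zero = trans (sym (sumFin-cong entry)) (trans (orthogonal r s) (if-distinct (r F.≟ s)))
      where
      if-distinct : (eq? : Dec (r ≡ s)) → (if does eq? then + N else + 0) ≡ + 0
      if-distinct (yes r≡s) = ⊥-elim (r≢s r≡s)
      if-distinct (no _)    = refl
    twice-weight : + (2 * weight d) ≡ + (4 * n)
    twice-weight = begin
      + (2 * weight d)                                   ≡⟨ cong (λ v → + (2 * weight v)) (tabulate∘lookup d) ⟨
      + (2 * weight (tabulate h))                        ≡⟨ cong (ℤ._+ + (2 * weight (tabulate h))) row-product-zero ⟨
      sumFin (sign ∘ h) ℤ.+ + (2 * weight (tabulate h)) ≡⟨ signSum N h ⟩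
      + N                                                ∎
      where open ≡-Reasoning

module Code (n : ℕ) .{{nzn : NonZero n}} (g : Len.BinVec n)
            (balanced : Vectors.DifferenceBalanced n g) where
  open Len n
  open Shift n
  open Vectors n

  G : Fin N → Bool
  G k = lookup g k

  lookup-cw : ∀ i ξ k → lookup (cw g i ξ) k ≡ (G k xor G (k ⊟ i)) xor ξ
  lookup-cw i ξ k = trans (lookup-⊕ (g ⊕ xpow i g) (scaleU ξ) k)
    (cong₂ _xor_ (trans (lookup-⊕ g (xpow i g) k) (cong (G k xor_) (lookup-xpow i g k))) (lookup-scaleU ξ k))

  cw-star : ∀ i j ξ ξ′ → cw g i ξ ⊕ xpow i (cw g j ξ′) ≡ cw g (i + j) (ξ xor ξ′)
  cw-star i j ξ ξ′ = ext λ k → begin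
    lookup (cw g i ξ ⊕ xpow i (cw g j ξ′)) k
      ≡⟨ lookup-⊕ (cw g i ξ) _ k ⟩
    lookup (cw g i ξ) k xor lookup (xpow i (cw g j ξ′)) k
      ≡⟨ cong₂ _xor_ (lookup-cw i ξ k) (trans (lookup-xpow i (cw g j ξ′) k) (lookup-cw j ξ′ (k ⊟ i))) ⟩
    ((G k xor G (k ⊟ i)) xor ξ) xor ((G (k ⊟ i) xor G ((k ⊟ i) ⊟ j)) xor ξ′)
      ≡⟨ interchange (G k xor G (k ⊟ i)) ξ (G (k ⊟ i) xor G ((k ⊟ i) ⊟ j)) ξ′ ⟩
    ((G k xor G (k ⊟ i)) xor (G (k ⊟ i) xor G ((k ⊟ i) ⊟ j))) xor (ξ xor ξ′)
      ≡⟨ cong (_xor (ξ xor ξ′)) (xor-cancel-middle (G k) (G (k ⊟ i)) (G ((k ⊟ i) ⊟ j))) ⟩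
    (G k xor G ((k ⊟ i) ⊟ j)) xor (ξ xor ξ′)
      ≡⟨ cong (λ t → (G k xor G t) xor (ξ xor ξ′)) (⊟-⊟ k i j) ⟩
    (G k xor G (k ⊟ (i + j))) xor (ξ xor ξ′)
      ≡⟨ lookup-cw (i + j) (ξ xor ξ′) k ⟨
    lookup (cw g (i + j) (ξ xor ξ′)) k ∎
    where open ≡-Reasoning

  cw-difference : ∀ i j ξ ξ′ → cw g i ξ ⊕ cw g j ξ′ ≡ (xpow i g ⊕ xpow j g) ⊕ scaleU (ξ xor ξ′)
  cw-difference i j ξ ξ′ = ext λ k → begin
    lookup (cw g i ξ ⊕ cw g j ξ′) k
      ≡⟨ trans (lookup-⊕ (cw g i ξ) _ k) (cong₂ _xor_ (lookup-cw i ξ k) (lookup-cw j ξ′ k)) ⟩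
    ((G k xor G (k ⊟ i)) xor ξ) xor ((G k xor G (k ⊟ j)) xor ξ′)
      ≡⟨ interchange (G k xor G (k ⊟ i)) ξ (G k xor G (k ⊟ j)) ξ′ ⟩
    ((G k xor G (k ⊟ i)) xor (G k xor G (k ⊟ j))) xor (ξ xor ξ′)
      ≡⟨ cong (λ t → (t xor (G k xor G (k ⊟ j))) xor (ξ xor ξ′)) (xor-comm (G k) _) ⟩
    ((G (k ⊟ i) xor G k) xor (G k xor G (k ⊟ j))) xor (ξ xor ξ′)
      ≡⟨ cong (_xor (ξ xor ξ′)) (xor-cancel-middle (G (k ⊟ i)) (G k) (G (k ⊟ j))) ⟩
    (G (k ⊟ i) xor G (k ⊟ j)) xor (ξ xor ξ′)
      ≡⟨ cong₂ _xor_ (sym (trans (lookup-⊕ (xpow i g) (xpow j g) k)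
                               (cong₂ _xor_ (lookup-xpow i g k) (lookup-xpow j g k))))
                     (sym (lookup-scaleU (ξ xor ξ′) k)) ⟩
    lookup (xpow i g ⊕ xpow j g) k xor lookup (scaleU (ξ xor ξ′)) k
      ≡⟨ lookup-⊕ (xpow i g ⊕ xpow j g) _ k ⟨
    lookup ((xpow i g ⊕ xpow j g) ⊕ scaleU (ξ xor ξ′)) k ∎
    where open ≡-Reasoning

  -- Adding u complements, and complementing preserves weight N/2.
  weight-⊕-scaleU : ∀ v b → weight v ≡ 2 * n → weight (v ⊕ scaleU b) ≡ 2 * n
  weight-⊕-scaleU v false wv = trans (cong weight (ext {v ⊕ scaleU false} {v} λ k →
    trans (lookup-⊕ v _ k) (trans (cong (lookup v k xor_) (lookup-scaleU false k))
                           (xor-identityʳ (lookup v k))))) wv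
  weight-⊕-scaleU v true wv = trans (cong weight v⊕u≡v̄) (+-cancelʳ-≡ (2 * n) _ _
    (trans (cong (ℕ._+_ (weight (complement v))) (sym wv)) (trans (weight-complement v) (*-distribʳ-+ n 2 2))))
    where
    v⊕u≡v̄ : v ⊕ scaleU true ≡ complement v
    v⊕u≡v̄ = ext λ k → trans (lookup-⊕ v _ k) (trans (cong (lookup v k xor_) (lookup-scaleU true k))
      (trans (xor-comm _ true) (trans (true-xor _) (sym (lookup-complement v k)))))

  cw-distance : ∀ (i j : Fin N) ξ ξ′ → i ≢ j → dist (cw g (toℕ i) ξ) (cw g (toℕ j) ξ′) ≡ 2 * n
  cw-distance i j ξ ξ′ i≢j = trans (cong weight (cw-difference (toℕ i) (toℕ j) ξ ξ′))
    (weight-⊕-scaleU (xpow (toℕ i) g ⊕ xpow (toℕ j) g) (ξ xor ξ′) (balanced i j i≢j))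

  dist-self : ∀ v → dist v v ≡ 0
  dist-self v = trans (cong weight (ext {v ⊕ v} {zeroV} λ k →
    trans (lookup-⊕ v v k) (trans (xor-same (lookup v k)) (sym (lookup-replicate k false))))) (weight-zero N)

  -- (i, ξ) ↦ g + xⁱg + ξu is injective: distinct shifts are at distance 2n ≠ 0,
  -- and for equal shifts ξ is read off any coordinate.
  cw-injective : ∀ i j ξ ξ′ → cw g (toℕ i) ξ ≡ cw g (toℕ j) ξ′ → i ≡ j × ξ ≡ ξ′
  cw-injective i j ξ ξ′ eq with i F.≟ j
  ... | no i≢j = ⊥-elim (ℕ.≢-nonZero⁻¹ (2 * n) (trans (sym (cw-distance i j ξ ξ′ i≢j))
                   (trans (cong (λ v → dist v (cw g (toℕ j) ξ′)) eq) (dist-self (cw g (toℕ j) ξ′)))))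
    where instance _ = m*n≢0 2 n
  ... | yes refl = refl , xor-injectiveʳ (G 0F xor G (0F ⊟ toℕ i)) (trans (sym (lookup-cw (toℕ i) ξ 0F))
                     (trans (cong (λ v → lookup v 0F) eq) (lookup-cw (toℕ i) ξ′ 0F)))

  cw-complement : ∀ i ξ → complement (cw g i ξ) ≡ cw g i (not ξ)
  cw-complement i ξ = ext λ k → trans (lookup-complement (cw g i ξ) k)
    (trans (cong not (lookup-cw i ξ k)) (trans (not-distribʳ-xor (G k xor G (k ⊟ i)) ξ) (sym (lookup-cw i (not ξ) k))))

  lookup-cw-0F : ∀ ξ k → lookup (cw g (toℕ 0F) ξ) k ≡ ξ
  lookup-cw-0F ξ k = trans (lookup-cw (toℕ 0F) ξ k)
    (cong (_xor ξ) (trans (cong (λ t → G k xor G (k ⊟ t)) toℕ-0F)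
                          (trans (cong (λ t → G k xor G t) (⊟-zero k)) (xor-same (G k)))))

  zero-cw : zeroV ≡ cw g (toℕ 0F) false
  zero-cw = ext λ k → trans (lookup-replicate k false) (sym (lookup-cw-0F false k))

  u-cw : u ≡ cw g (toℕ 0F) true
  u-cw = ext λ k → trans (lookup-replicate k true) (sym (lookup-cw-0F true k))

  cw-⊞ : ∀ (i j : Fin N) ξ → cw g (toℕ (i ⊞ toℕ j)) ξ ≡ cw g (toℕ i + toℕ j) ξ
  cw-⊞ i j ξ = trans (cong (λ t → cw g t ξ) (toℕ-fromℕ< _)) (ext λ k →
    trans (lookup-cw _ ξ k) (trans (cong (λ t → (G k xor G t) xor ξ) (⊟-mod k (toℕ i + toℕ j)))
      (sym (lookup-cw _ ξ k))))

  C : BinVec → Set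
  C = InC g

  φ : Fin N × Bool → BinVec
  φ (i , ξ) = cw g (toℕ i) ξ

  φ-injective : ∀ p q → φ p ≡ φ q → p ≡ q
  φ-injective (i , ξ) (j , ξ′) eq with cw-injective i j ξ ξ′ eq
  ... | refl , refl = refl

  φ-onto : ∀ v → C v → ∃ λ p → φ p ≡ v
  φ-onto v (i , ξ , refl) = (i , ξ) , refl

  φ-in-C : ∀ p → C (φ p)
  φ-in-C (i , ξ) = i , ξ , refl

  -- Decoding: the shift index of a vector, found by exhaustive search over
  -- Fin N; it is unique on C by cw-injective.
  HasShift : BinVec → Fin N → Set
  HasShift v i = ∃ λ ξ → v ≡ cw g (toℕ i) ξ

  hasShift? : ∀ v i → Dec (HasShift v i)
  hasShift? v i with ≡-dec Data.Bool._≟_ v (cw g (toℕ i) false)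
                   | ≡-dec Data.Bool._≟_ v (cw g (toℕ i) true)
  ... | yes p | _     = yes (false , p)
  ... | no _  | yes q = yes (true , q)
  ... | no p  | no q  = no λ { (false , e) → p e ; (true , e) → q e }

  index : BinVec → Fin N
  index v with any? (hasShift? v)
  ... | yes (i , _) = i
  ... | no _        = 0F

  index-cw : ∀ i ξ → index (cw g (toℕ i) ξ) ≡ i
  index-cw i ξ with any? (hasShift? (cw g (toℕ i) ξ))
  ... | yes (j , ξ′ , eq) = sym (proj₁ (cw-injective i j ξ ξ′ eq))
  ... | no none           = ⊥-elim (none (i , ξ , refl))

  π : BinVec → Permutation′ N
  π v = shift (toℕ (index v))

  π-cw : ∀ i ξ k → π (cw g (toℕ i) ξ) ⟨$⟩ʳ k ≡ k ⊞ toℕ i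
  π-cw i ξ k = cong (λ j → k ⊞ toℕ j) (index-cw i ξ)

  star-cw : ∀ (i j : Fin N) ξ ξ′ → star π (cw g (toℕ i) ξ) (cw g (toℕ j) ξ′) ≡ cw g (toℕ i + toℕ j) (ξ xor ξ′)
  star-cw i j ξ ξ′ = trans (cong (λ p → cw g (toℕ i) ξ ⊕ act (shift (toℕ p)) (cw g (toℕ j) ξ′)) (index-cw i ξ))
                           (cw-star (toℕ i) (toℕ j) ξ ξ′)

  propelinear : IsPropelinear C π
  propelinear _ _ (i , ξ , refl) (j , ξ′ , refl) = (i ⊞ toℕ j , ξ xor ξ′ , product) , λ k → begin
    π x ⟨$⟩ʳ (π y ⟨$⟩ʳ k)                     ≡⟨ trans (π-cw i ξ _) (cong (_⊞ toℕ i) (π-cw j ξ′ k)) ⟩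
    (k ⊞ toℕ j) ⊞ toℕ i                       ≡⟨ ⊞-⊞ k (toℕ j) (toℕ i) ⟩
    k ⊞ (toℕ j + toℕ i)                       ≡⟨ cong (k ⊞_) (+-comm (toℕ j) (toℕ i)) ⟩
    k ⊞ (toℕ i + toℕ j)                       ≡⟨ trans (cong (k ⊞_) (toℕ-fromℕ< _)) (⊞-mod k (toℕ i + toℕ j)) ⟨
    k ⊞ toℕ (i ⊞ toℕ j)                       ≡⟨ π-cw (i ⊞ toℕ j) (ξ xor ξ′) k ⟨
    π (cw g (toℕ (i ⊞ toℕ j)) (ξ xor ξ′)) ⟨$⟩ʳ k ≡⟨ cong (λ v → π v ⟨$⟩ʳ k) product ⟨
    π (star π x y) ⟨$⟩ʳ k                      ∎
    where
    open ≡-Reasoning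
    x = cw g (toℕ i) ξ
    y = cw g (toℕ j) ξ′
    product : star π x y ≡ cw g (toℕ (i ⊞ toℕ j)) (ξ xor ξ′)
    product = trans (star-cw i j ξ ξ′) (sym (cw-⊞ i j _))

  size : HasSize C (2 * N)
  size = hasSize-via (↔-trans *↔× (↔-trans (×-cong 2↔Bool ↔-refl) (×-comm Bool (Fin N))))
                     φ φ-injective φ-onto φ-in-C

  same-shift : ∀ i ξ ξ′ → cw g i ξ ≡ cw g i ξ′ ⊎ cw g i ξ ≡ complement (cw g i ξ′)
  same-shift i false false = inj₁ refl
  same-shift i true  true  = inj₁ refl
  same-shift i false true  = inj₂ (sym (cw-complement i true))
  same-shift i true  false = inj₂ (sym (cw-complement i false))

  distances : ∀ x y → C x → C y → x ≢ y → x ≢ complement y → dist x y ≡ 2 * n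
  distances _ _ (i , ξ , refl) (j , ξ′ , refl) x≢y x≢ȳ with i F.≟ j
  ... | no i≢j  = cw-distance i j ξ ξ′ i≢j
  ... | yes refl = ⊥-elim ([ x≢y , x≢ȳ ] (same-shift (toℕ i) ξ ξ′))

  hadamardCode : IsHadamardCode C
  hadamardCode = (0F , false , zero-cw) , size , distances

  -- 0 and u are the codewords with shift 0, so their permutation is the identity.
  π-trivial : ∀ ξ → π (cw g (toℕ 0F) ξ) ≈ id
  π-trivial ξ k = trans (π-cw 0F ξ k) (trans (cong (k ⊞_) toℕ-0F) (⊞-zero k))

  π-zero : π zeroV ≈ id
  π-zero k = trans (cong (λ v → π v ⟨$⟩ʳ k) zero-cw) (π-trivial false k)

  π-u : π u ≈ id
  π-u k = trans (cong (λ v → π v ⟨$⟩ʳ k) u-cw) (π-trivial true k)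

  -- Only 0 and u have the trivial shift; every other codeword moves all coordinates.
  fixed-point-free : ∀ v → C v → v ≢ zeroV → v ≢ u → ∀ k → π v ⟨$⟩ʳ k ≢ k
  fixed-point-free _ (i , ξ , refl) v≢0 v≢u k fixed = [ v≢0 , v≢u ] (trivial ξ)
    where
    i≡0F : i ≡ 0F
    i≡0F = toℕ-injective (trans (⊞-fixed⇒zero k (toℕ i) (toℕ<n i) (trans (sym (π-cw i ξ k)) fixed))
                                (sym toℕ-0F))
    trivial : ∀ ξ → cw g (toℕ i) ξ ≡ zeroV ⊎ cw g (toℕ i) ξ ≡ u
    trivial false = inj₁ (trans (cong (λ j → cw g (toℕ j) false) i≡0F) (sym zero-cw))
    trivial true  = inj₂ (trans (cong (λ j → cw g (toℕ j) true) i≡0F) (sym u-cw))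

  shift-power : ∀ m k → powP (shift 1) m ⟨$⟩ʳ k ≡ k ⊞ m
  shift-power zero    k = sym (⊞-zero k)
  shift-power (suc m) k = trans (shift-power m (k ⊞ 1)) (⊞-⊞ k 1 m)

  cyclic : PiCyclicOfOrder C π N
  cyclic = shift 1 , generated , realised , (λ k → trans (shift-power N k) (⊞-N k)) , order
    where
    generated : ∀ z → C z → ∃ λ m → π z ≈ powP (shift 1) m
    generated _ (i , ξ , refl) = toℕ i , λ k → trans (π-cw i ξ k) (sym (shift-power _ k))
    realised : ∀ m → ∃ λ z → C z × π z ≈ powP (shift 1) m
    realised m = cw g (toℕ i) false , (i , false , refl) , λ k →
      trans (π-cw i false k) (trans (cong (k ⊞_) (toℕ-fromℕ< _)) (trans (⊞-mod k m) (sym (shift-power m k))))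
      where i = fromℕ< (m%n<n m N)
    order : ∀ m → 0 < m → m < N → ¬ (powP (shift 1) m ≈ id)
    order m 0<m m<N trivial =
      <-irrefl refl (subst (0 <_) (⊞-fixed⇒zero 0F m m<N (trans (sym (shift-power m 0F)) (trivial 0F))) 0<m)

  type : TypeCN×C2 C π
  type = φ , φ-in-C , φ-injective , φ-onto ,
         (λ i j ξ ξ′ → trans (cw-⊞ i j _) (sym (star-cw i j ξ ξ′))) , sym u-cw

proposition2p2 :
    (n : ℕ) .{{_ : NonZero n}} (a : Fin (Len.N n) → ℤ) →
    Len.IsCirculantHadamard n a →
    Σ (Len.BinVec n → Permutation′ (Len.N n)) λ π →
      Len.IsHFP n (Len.InC n (Len.genPoly n a)) π ×
      (∀ (i : Fin (Len.N n)) (ξ : Bool) (k : Fin (Len.N n)) →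
        π (Len.cw n (Len.genPoly n a) (toℕ i) ξ) ⟨$⟩ʳ k ≡ Len._⊞_ n k (toℕ i)) ×
      (∀ (i j : Fin (Len.N n)) (ξ ξ′ : Bool) →
        Len.star n π (Len.cw n (Len.genPoly n a) (toℕ i) ξ) (Len.cw n (Len.genPoly n a) (toℕ j) ξ′)
          ≡ Len.cw n (Len.genPoly n a) (toℕ i + toℕ j) (ξ xor ξ′)) ×
      Len.PiCyclicOfOrder n (Len.InC n (Len.genPoly n a)) π (Len.N n) ×
      Len.TypeCN×C2 n (Len.InC n (Len.genPoly n a)) π
proposition2p2 n a hadamard =
  π , (propelinear , hadamardCode , π-zero , π-u , fixed-point-free) , π-cw , star-cw , cyclic , type
  where open Code n (Len.genPoly n a) (Hadamard.hadamard⇒balanced n a hadamard)
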